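{- Let $M$ be the free monoid generated by the countable set $\{m_i : i\in\mathbb{N}\}$. Let $A=\{a_n : n\in\mathbb{N}\}$ and $B=\{b_n : n\in\mathbb{N}\}$ be disjoint sets (all $a_n$, $b_n$ pairwise distinct), and $C=A\cup B$. Let $\mathcal{C}: M\times C\to C$ be the action of $M$ on $C$ determined on generators by \[ \mathcal{C}(m_n,x)=\begin{cases} a_k & \text{if } x=a_k \text{ and } k\neq n,\\ b_k & \text{if } x=a_k \text{ and } k=n,\\ b_k & \text{if } x=b_k,\end{cases} \] (and extended to all words of $M$ by composition). Then every injective morphism of $M$-sets $\mathcal{F}:\mathcal{C}\to\mathcal{C}$ is the identity $\mathrm{Id}_{\mathcal{C}}$.
   Context: An $M$-set (for a monoid $M$) is a set $X$ with an action $X\times M\to X$ compatible with the monoid multiplication and unit. A morphism of $M$-sets $\mathcal{F}:\mathcal{X}\to\mathcal{Y}$ is a function $F$ between the underlying sets which is equivariant: $F(\mathcal{X}(m,x))=\mathcal{Y}(m,F(x))$ for all $m\in M$ and all $x$. Injective means the underlying function is injective. -}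

module Defs where

open import Data.Nat using (ℕ; _≟_)
open import Data.List using (List; []; _∷_)
open import Relation.Nullary using (yes; no)
open import Relation.Binary.PropositionalEquality using (_≡_)
open import Function.Definitions using (Injective)

M : Set
M = List ℕ

data C : Set where
  a : ℕ → C
  b : ℕ → C

genAct : ℕ → C → C
genAct n (a k) with k ≟ n
... | yes _ = b k
... | no  _ = a k
genAct n (b k) = b k

-- Action of a word (right action: x · (m_{i1} m_{i2} ... m_{ik}) applies
-- m_{i1} first, then m_{i2}, ...), i.e. extension to M by composition.
act : M → C → C
act []      x = x
act (n ∷ w) x = act w (genAct n x)

IsMorphism : (C → C) → Set
IsMorphism F = ∀ (w : M) (x : C) → F (act w x) ≡ act w (F x)

IsInjective : (C → C) → Set
IsInjective F = Injective _≡_ _≡_ F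

-- The generator m_k separates a_k from b_k and fixes everything else, so
-- equivariance pins F down. If F a_k = b_j then F b_k = m_k (F a_k) = b_j as
-- well, contradicting injectivity; if F a_k = a_j with j ≠ k then
-- F a_k = F (m_j a_k) = m_j a_j = b_j, which is absurd. Hence F a_k = a_k,
-- and F b_k = F (m_k a_k) = m_k (F a_k) = m_k a_k = b_k.
module Submission where

open import Defs
open import Data.Nat using (_≟_)
open import Data.List using ([]; _∷_)
open import Relation.Nullary using (yes; no)
open import Relation.Binary.PropositionalEquality
  using (_≡_; _≢_; refl; sym; cong; module ≡-Reasoning)

open ≡-Reasoning

genAct-self : ∀ n → genAct n (a n) ≡ b n
genAct-self n with n ≟ n
... | yes _   = refl
... | no  n≢n with () ← n≢n refl

genAct-other : ∀ {k n} → k ≢ n → genAct n (a k) ≡ a k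
genAct-other {k} {n} k≢n with k ≟ n
... | yes k≡n with () ← k≢n k≡n
... | no  _   = refl

a≢b : ∀ {i j} → a i ≢ b j
a≢b ()

module _ {F : C → C} (F-mor : IsMorphism F) where

  commutes-genAct : ∀ n x → F (genAct n x) ≡ genAct n (F x)
  commutes-genAct n = F-mor (n ∷ [])

  F-b : ∀ k → F (b k) ≡ genAct k (F (a k))
  F-b k = begin
    F (b k)              ≡⟨ cong F (genAct-self k) ⟨
    F (genAct k (a k))   ≡⟨ commutes-genAct k (a k) ⟩
    genAct k (F (a k))   ∎

  F-a≡a⇒index : ∀ {k j} → F (a k) ≡ a j → j ≡ k
  F-a≡a⇒index {k} {j} Fak≡aj with j ≟ k
  ... | yes j≡k = j≡k
  ... | no  j≢k with () ← a≢b (begin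
    a j                  ≡⟨ Fak≡aj ⟨
    F (a k)              ≡⟨ cong F (genAct-other (λ k≡j → j≢k (sym k≡j))) ⟨
    F (genAct j (a k))   ≡⟨ commutes-genAct j (a k) ⟩
    genAct j (F (a k))   ≡⟨ cong (genAct j) Fak≡aj ⟩
    genAct j (a j)       ≡⟨ genAct-self j ⟩
    b j                  ∎)

  F-a≢b : IsInjective F → ∀ {k j} → F (a k) ≢ b j
  F-a≢b F-inj {k} {j} Fak≡bj = a≢b (F-inj (begin
    F (a k)              ≡⟨ Fak≡bj ⟩
    b j                  ≡⟨⟩
    genAct k (b j)       ≡⟨ cong (genAct k) Fak≡bj ⟨
    genAct k (F (a k))   ≡⟨ F-b k ⟨
    F (b k)              ∎))

  F-a : IsInjective F → ∀ k → F (a k) ≡ a k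
  F-a F-inj k with F (a k) in Fak≡
  ... | a j = cong a (F-a≡a⇒index Fak≡)
  ... | b j with () ← F-a≢b F-inj Fak≡

fact4 : (F : C → C) → IsMorphism F → IsInjective F → ∀ (x : C) → F x ≡ x
fact4 F F-mor F-inj (a k) = F-a F-mor F-inj k
fact4 F F-mor F-inj (b k) = begin
  F (b k)              ≡⟨ F-b F-mor k ⟩
  genAct k (F (a k))   ≡⟨ cong (genAct k) (F-a F-mor F-inj k) ⟩
  genAct k (a k)       ≡⟨ genAct-self k ⟩
  b k                  ∎
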